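{- Let $2\le k<\ell$ be integers, let $H=(V,E)$ be a hypergraph all of whose edges have size $k$ or $\ell$, and let $p,q\in(0,1]$ with $p\ge q$. Define $g(e)=p$ if $|e|=k$ and $g(e)=q$ if $|e|=\ell$. Let $x$ be a reduced basic fractional matching of $H$ which is stuck for $g$. For an edge $e$ and $i\in\{k,\ell\}$ let $a_i(e)=\sum_{f\in N(e),\,|f|=i}x(f)$. Then for every edge $e$ with $|e|=k$ and every edge $f$ with $|f|=\ell$, \[ x(e)<\frac{kp-1-(p-q)a_\ell(e)}{(k-1)p}\qquad\text{and}\qquad x(f)<\frac{\ell q-1+(p-q)a_k(f)}{(\ell-1)q}. \]
   Context: A hypergraph $H=(V,E)$ has finite vertex set $V$ and a finite set $E$ of nonempty subsets of $V$. For an edge $e$, $N(e)=\{f\in E: f\neq e,\ f\cap e\neq\emptyset\}$. A fractional matching of $H$ is $x:E\to[0,1]$ with $\sum_{e\ni v}x(e)\le1$ for all $v$; it is basic if it is an extreme point of the fractional matching polytope; it is reduced if $x(e)\in(0,1)$ for all $e$. A basic fractional matching $x$ is stuck for $g$ if for every edge $e$, $\sum_{f\in N(e)}g(f)x(f)>1-g(e)x(e)$.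
   Formalization: The parameters p and q, the values of x, and the points and coefficient tested in the extreme-point condition defining basic fractional matchings are rational rather than real. -}

module Defs where

open import Data.Nat as ℕ using (ℕ; zero; suc)
open import Data.Bool using (Bool; true; false; if_then_else_; _∧_; not)
open import Data.Fin using (Fin; zero; suc)
open import Data.Fin.Subset using (Subset; _∩_; ∣_∣)
open import Data.Vec using (lookup)
open import Data.Integer using (+_)
open import Data.Rational using (ℚ; 0ℚ; 1ℚ; _+_; _*_; _-_; _≤_; _<_; _/_)
open import Data.Product using (_×_)
open import Relation.Binary.PropositionalEquality using (_≡_)
open import Relation.Nullary using (does)
import Data.Fin as F

-- A hypergraph on vertex set Fin n with m edges, edge i being the subset E i.
-- (Distinctness of edges and nonemptiness are imposed as hypotheses.)

ℕ→ℚ : ℕ → ℚ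
ℕ→ℚ k = (+ k) / 1

sumFin : (m : ℕ) → (Fin m → ℚ) → ℚ
sumFin zero    f = 0ℚ
sumFin (suc m) f = f zero + sumFin m (λ i → f (suc i))

sumWhere : (m : ℕ) → (Fin m → Bool) → (Fin m → ℚ) → ℚ
sumWhere m P f = sumFin m (λ i → if P i then f i else 0ℚ)

module _ {n m : ℕ} (E : Fin m → Subset n) where

  incident : Fin n → Fin m → Bool
  incident v e = lookup (E e) v

  inN : Fin m → Fin m → Bool
  inN e f = not (does (e F.≟ f)) ∧ not (∣ E f ∩ E e ∣ ℕ.≡ᵇ 0)

  IsFracMatching : (Fin m → ℚ) → Set
  IsFracMatching x =
    ((e : Fin m) → (0ℚ ≤ x e) × (x e ≤ 1ℚ)) ×
    ((v : Fin n) → sumWhere m (incident v) x ≤ 1ℚ)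

  -- basic = extreme point of the fractional matching polytope:
  -- x is in the polytope, and whenever x = λ y + (1-λ) z with 0<λ<1 and
  -- y, z in the polytope, then y = z.
  IsBasic : (Fin m → ℚ) → Set
  IsBasic x = IsFracMatching x ×
    ((y z : Fin m → ℚ) (λ' : ℚ) → 0ℚ < λ' → λ' < 1ℚ →
      IsFracMatching y → IsFracMatching z →
      ((e : Fin m) → x e ≡ λ' * y e + (1ℚ - λ') * z e) →
      (e : Fin m) → y e ≡ z e)

  IsReduced : (Fin m → ℚ) → Set
  IsReduced x = (e : Fin m) → (0ℚ < x e) × (x e < 1ℚ)

  IsStuck : (Fin m → ℚ) → (Fin m → ℚ) → Set
  IsStuck g x = (e : Fin m) →
    1ℚ - g e * x e < sumWhere m (inN e) (λ f → g f * x f)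

  aSum : ℕ → (Fin m → ℚ) → Fin m → ℚ
  aSum i x e = sumWhere m (λ f → inN e f ∧ (∣ E f ∣ ℕ.≡ᵇ i)) x

  gFun : ℕ → ℚ → ℚ → Fin m → ℚ
  gFun k p q e = if ∣ E e ∣ ℕ.≡ᵇ k then p else q

module Submission where

open import Defs
open import Data.Nat as ℕ using (ℕ; zero; suc)
import Data.Nat.Properties as ℕ
open import Data.Nat.Coprimality using (1-coprimeTo) renaming (sym to coprime-sym)
open import Data.Fin using (Fin; zero; suc)
import Data.Fin as F
open import Data.Fin.Subset using (Subset; _∩_; ∣_∣)
open import Data.Fin.Subset.Properties using (∩-idem)
open import Data.Vec using (Vec; []; _∷_; lookup)
open import Data.Bool using (Bool; true; false; if_then_else_; _∧_; not)
import Data.Integer as ℤ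
import Data.Integer.Properties as ℤ
open import Data.Rational using (ℚ; 0ℚ; 1ℚ; _+_; _*_; _-_; -_; _≤_; _<_; _/_; nonNegative)
open import Data.Rational.Properties
open import Data.Rational.Solver using (module +-*-Solver)
open import Data.Product using (_×_; _,_; proj₁)
open import Data.Sum using (_⊎_; inj₁; inj₂)
open import Function.Definitions using (Injective)
open import Relation.Nullary using (does; yes; no)
open import Relation.Nullary.Decidable using (dec-true; dec-false)
open import Relation.Binary.PropositionalEquality
  using (_≡_; _≢_; refl; sym; trans; cong; cong₂; subst; module ≡-Reasoning)
open +-*-Solver

-- Summing the vertex constraints over the vertices of an edge e counts x(e) once per
-- vertex of e and every neighbour at least once, so |e| x(e) + a_k(e) + a_ℓ(e) ≤ |e|.
-- Stuckness gives 1 - g(e) x(e) < p a_k(e) + q a_ℓ(e), and this right-hand side is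
-- g(e) (a_k(e) + a_ℓ(e)) - (p - q) a_ℓ(e) if |e| = k and g(e) (a_k(e) + a_ℓ(e)) + (p - q) a_k(e)
-- if |e| = ℓ; substituting the first bound for a_k(e) + a_ℓ(e) gives both inequalities.

ℕ→ℚ-suc : ∀ j → ℕ→ℚ (suc j) ≡ 1ℚ + ℕ→ℚ j
ℕ→ℚ-suc j = sym (begin
  1ℚ + ℕ→ℚ j                           ≡⟨ cong (1ℚ +_) (normalize-coprime (coprime-sym (1-coprimeTo j))) ⟩
  (ℤ.+ 1 ℤ.+ ℤ.+ j ℤ.* ℤ.+ 1) / 1      ≡⟨ cong (λ z → (ℤ.+ 1 ℤ.+ z) / 1) (ℤ.*-identityʳ (ℤ.+ j)) ⟩
  ℕ→ℚ (suc j)                          ∎)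
  where open ≡-Reasoning

ℕ→ℚ-nonNeg : ∀ j → 0ℚ ≤ ℕ→ℚ j
ℕ→ℚ-nonNeg j = nonNegative⁻¹ (ℕ→ℚ j) {{normalize-nonNeg j 1}}

*-nonNeg : ∀ {r s} → 0ℚ ≤ r → 0ℚ ≤ s → 0ℚ ≤ r * s
*-nonNeg {r} 0≤r 0≤s = subst (_≤ r * _) (*-zeroʳ r) (*-monoˡ-≤-nonNeg r {{nonNegative 0≤r}} 0≤s)

stuck-bound : ∀ {r X K s t} → 0ℚ ≤ r → X * K + s ≤ K → 1ℚ - r * X < t →
  X * ((K - 1ℚ) * r) < K * r - 1ℚ + (t - r * s)
stuck-bound {r} {X} {K} {s} {t} 0≤r load stuck = begin-strict
  X * ((K - 1ℚ) * r)                     ≡⟨ solve 4 (λ r X K s → X :* ((K :- con 1ℚ) :* r)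
                                              := r :* (X :* K :+ s) :+ (((con 1ℚ :- r :* X) :- con 1ℚ) :- r :* s))
                                              refl r X K s ⟩
  r * (X * K + s) + (((1ℚ - r * X) - 1ℚ) - r * s)
                                         ≤⟨ +-monoˡ-≤ _ (*-monoˡ-≤-nonNeg r {{nonNegative 0≤r}} load) ⟩
  r * K + (((1ℚ - r * X) - 1ℚ) - r * s)  <⟨ +-monoʳ-< (r * K) (+-monoˡ-< (- (r * s)) (+-monoˡ-< (- 1ℚ) stuck)) ⟩
  r * K + ((t - 1ℚ) - r * s)             ≡⟨ solve 4 (λ r K s t → r :* K :+ ((t :- con 1ℚ) :- r :* s)
                                              := K :* r :- con 1ℚ :+ (t :- r :* s)) refl r K s t ⟩
  K * r - 1ℚ + (t - r * s)               ∎
  where open ≤-Reasoning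

sumFin-cong : ∀ m {f g : Fin m → ℚ} → (∀ i → f i ≡ g i) → sumFin m f ≡ sumFin m g
sumFin-cong zero    f≗g = refl
sumFin-cong (suc m) f≗g = cong₂ _+_ (f≗g zero) (sumFin-cong m (λ i → f≗g (suc i)))

sumFin-zero : ∀ m → sumFin m (λ _ → 0ℚ) ≡ 0ℚ
sumFin-zero zero    = refl
sumFin-zero (suc m) = trans (+-identityˡ _) (sumFin-zero m)

sumFin-+ : ∀ m (f g : Fin m → ℚ) → sumFin m (λ i → f i + g i) ≡ sumFin m f + sumFin m g
sumFin-+ zero    f g = sym (+-identityʳ 0ℚ)
sumFin-+ (suc m) f g =
  trans (cong (f zero + g zero +_) (sumFin-+ m (λ i → f (suc i)) (λ i → g (suc i))))
        (solve 4 (λ a b c d → (a :+ b) :+ (c :+ d) := (a :+ c) :+ (b :+ d)) refl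
           (f zero) (g zero) (sumFin m (λ i → f (suc i))) (sumFin m (λ i → g (suc i))))

sumFin-*ˡ : ∀ m c (f : Fin m → ℚ) → sumFin m (λ i → c * f i) ≡ c * sumFin m f
sumFin-*ˡ zero    c f = sym (*-zeroʳ c)
sumFin-*ˡ (suc m) c f =
  trans (cong (c * f zero +_) (sumFin-*ˡ m c (λ i → f (suc i))))
        (sym (*-distribˡ-+ c (f zero) (sumFin m (λ i → f (suc i)))))

sumFin-mono-≤ : ∀ m {f g : Fin m → ℚ} → (∀ i → f i ≤ g i) → sumFin m f ≤ sumFin m g
sumFin-mono-≤ zero    f≤g = ≤-refl
sumFin-mono-≤ (suc m) f≤g = +-mono-≤ (f≤g zero) (sumFin-mono-≤ m (λ i → f≤g (suc i)))

sumFin-comm : ∀ n m (h : Fin n → Fin m → ℚ) →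
  sumFin n (λ v → sumFin m (h v)) ≡ sumFin m (λ f → sumFin n (λ v → h v f))
sumFin-comm zero    m h = sym (sumFin-zero m)
sumFin-comm (suc n) m h =
  trans (cong (sumFin m (h zero) +_) (sumFin-comm n m (λ v → h (suc v))))
        (sym (sumFin-+ m (h zero) (λ f → sumFin n (λ v → h (suc v) f))))

sumFin-δ : ∀ m (e : Fin m) c → sumFin m (λ f → if does (e F.≟ f) then c else 0ℚ) ≡ c
sumFin-δ (suc m) zero    c = trans (cong (c +_) (sumFin-zero m)) (+-identityʳ c)
sumFin-δ (suc m) (suc e) c = trans (+-identityˡ _) (sumFin-δ m e c)

if-sumFin : ∀ m b (f : Fin m → ℚ) →
  (if b then sumFin m f else 0ℚ) ≡ sumFin m (λ i → if b then f i else 0ℚ)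
if-sumFin m true  f = refl
if-sumFin m false f = sym (sumFin-zero m)

sumFin-∩ : ∀ {n} (a b : Vec Bool n) c →
  sumFin n (λ v → if lookup a v then (if lookup b v then c else 0ℚ) else 0ℚ) ≡ c * ℕ→ℚ ∣ b ∩ a ∣
sumFin-∩ []          []          c = sym (*-zeroʳ c)
sumFin-∩ {suc n} (true ∷ a) (true ∷ b) c = begin
  c + sumFin n (λ v → if lookup a v then (if lookup b v then c else 0ℚ) else 0ℚ)
                           ≡⟨ cong (c +_) (sumFin-∩ a b c) ⟩
  c + c * ℕ→ℚ ∣ b ∩ a ∣    ≡⟨ solve 2 (λ c N → c :+ c :* N := c :* (con 1ℚ :+ N)) refl c (ℕ→ℚ ∣ b ∩ a ∣) ⟩
  c * (1ℚ + ℕ→ℚ ∣ b ∩ a ∣) ≡⟨ cong (c *_) (sym (ℕ→ℚ-suc ∣ b ∩ a ∣)) ⟩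
  c * ℕ→ℚ (suc ∣ b ∩ a ∣)  ∎
  where open ≡-Reasoning
sumFin-∩ (true ∷ a)  (false ∷ b) c = trans (+-identityˡ _) (sumFin-∩ a b c)
sumFin-∩ (false ∷ a) (true ∷ b)  c = trans (+-identityˡ _) (sumFin-∩ a b c)
sumFin-∩ (false ∷ a) (false ∷ b) c = trans (+-identityˡ _) (sumFin-∩ a b c)

if-partition : ∀ b c (y : ℚ) →
  (if b then y else 0ℚ) ≡ (if b ∧ c then y else 0ℚ) + (if b ∧ not c then y else 0ℚ)
if-partition false c     y = sym (+-identityʳ 0ℚ)
if-partition true  true  y = sym (+-identityʳ y)
if-partition true  false y = sym (+-identityˡ y)

if-select : ∀ b c (p q y : ℚ) →
  (if b then (if c then p else q) * y else 0ℚ) ≡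
    p * (if b ∧ c then y else 0ℚ) + q * (if b ∧ not c then y else 0ℚ)
if-select false c     p q y = sym (trans (cong₂ _+_ (*-zeroʳ p) (*-zeroʳ q)) (+-identityʳ 0ℚ))
if-select true  true  p q y = sym (trans (cong (p * y +_) (*-zeroʳ q)) (+-identityʳ _))
if-select true  false p q y = sym (trans (cong (_+ q * y) (*-zeroʳ p)) (+-identityˡ _))

module _ {m : ℕ} (b c c′ : Fin m → Bool) (c′≗¬c : ∀ i → c′ i ≡ not (c i)) where

  private
    if-∧-c′ : ∀ i (y : ℚ) → (if b i ∧ not (c i) then y else 0ℚ) ≡ (if b i ∧ c′ i then y else 0ℚ)
    if-∧-c′ i y = cong (λ z → if b i ∧ z then y else 0ℚ) (sym (c′≗¬c i))

  sumWhere-partition : ∀ y →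
    sumWhere m b y ≡ sumWhere m (λ i → b i ∧ c i) y + sumWhere m (λ i → b i ∧ c′ i) y
  sumWhere-partition y = trans
    (sumFin-cong m (λ i → trans (if-partition (b i) (c i) (y i)) (cong ((if b i ∧ c i then y i else 0ℚ) +_) (if-∧-c′ i (y i)))))
    (sumFin-+ m _ _)

  sumWhere-select : ∀ p q y →
    sumWhere m b (λ i → (if c i then p else q) * y i) ≡
      p * sumWhere m (λ i → b i ∧ c i) y + q * sumWhere m (λ i → b i ∧ c′ i) y
  sumWhere-select p q y = trans
    (sumFin-cong m (λ i → trans (if-select (b i) (c i) p q (y i))
                                (cong (λ z → p * (if b i ∧ c i then y i else 0ℚ) + q * z) (if-∧-c′ i (y i)))))
    (trans (sumFin-+ m _ _) (cong₂ _+_ (sumFin-*ˡ m p (λ i → if b i ∧ c i then y i else 0ℚ))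
                                       (sumFin-*ˡ m q (λ i → if b i ∧ c′ i then y i else 0ℚ))))

module _ {n m : ℕ} (E : Fin m → Subset n) (x : Fin m → ℚ) where

  sumFin-overlap : ∀ a → sumFin m (λ f → x f * ℕ→ℚ ∣ E f ∩ a ∣) ≡
    sumFin n (λ v → if lookup a v then sumWhere m (incident E v) x else 0ℚ)
  sumFin-overlap a = begin
    sumFin m (λ f → x f * ℕ→ℚ ∣ E f ∩ a ∣)  ≡⟨ sumFin-cong m (λ f → sym (sumFin-∩ a (E f) (x f))) ⟩
    sumFin m (λ f → sumFin n (λ v → h v f)) ≡⟨ sym (sumFin-comm n m h) ⟩
    sumFin n (λ v → sumFin m (h v))         ≡⟨ sumFin-cong n (λ v → sym (if-sumFin m (lookup a v) _)) ⟩
    sumFin n (λ v → if lookup a v then sumWhere m (incident E v) x else 0ℚ) ∎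
    where
    open ≡-Reasoning
    h : Fin n → Fin m → ℚ
    h v f = if lookup a v then (if lookup (E f) v then x f else 0ℚ) else 0ℚ

  self+neighbour≤overlap : (∀ f → 0ℚ ≤ x f) → ∀ e f →
    (if does (e F.≟ f) then x e * ℕ→ℚ ∣ E e ∣ else 0ℚ) + (if inN E e f then x f else 0ℚ)
      ≤ x f * ℕ→ℚ ∣ E f ∩ E e ∣
  self+neighbour≤overlap x≥0 e f with e F.≟ f
  ... | yes refl = ≤-reflexive (trans (+-identityʳ _) (cong (λ s → x e * ℕ→ℚ ∣ s ∣) (sym (∩-idem (E e)))))
  ... | no _ with ∣ E f ∩ E e ∣
  ...   | zero  = ≤-reflexive (trans (+-identityʳ 0ℚ) (sym (*-zeroʳ (x f))))
  ...   | suc c = begin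
    0ℚ + x f                 ≡⟨ +-comm 0ℚ (x f) ⟩
    x f + 0ℚ                 ≤⟨ +-monoʳ-≤ (x f) (*-nonNeg (x≥0 f) (ℕ→ℚ-nonNeg c)) ⟩
    x f + x f * ℕ→ℚ c        ≡⟨ solve 2 (λ y N → y :+ y :* N := y :* (con 1ℚ :+ N)) refl (x f) (ℕ→ℚ c) ⟩
    x f * (1ℚ + ℕ→ℚ c)       ≡⟨ cong (x f *_) (sym (ℕ→ℚ-suc c)) ⟩
    x f * ℕ→ℚ (suc c)        ∎
    where open ≤-Reasoning

  neighbourhood-load : IsFracMatching E x → ∀ e →
    x e * ℕ→ℚ ∣ E e ∣ + sumWhere m (inN E e) x ≤ ℕ→ℚ ∣ E e ∣
  neighbourhood-load (x-bounds , vertex-bound) e = begin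
    size·x + sumFin m neighbour      ≡⟨ cong (_+ sumFin m neighbour) (sym (sumFin-δ m e size·x)) ⟩
    sumFin m self + sumFin m neighbour
                                     ≡⟨ sym (sumFin-+ m self neighbour) ⟩
    sumFin m (λ f → self f + neighbour f)
                                     ≤⟨ sumFin-mono-≤ m (self+neighbour≤overlap (λ f → proj₁ (x-bounds f)) e) ⟩
    sumFin m (λ f → x f * ℕ→ℚ ∣ E f ∩ E e ∣)
                                     ≡⟨ sumFin-overlap (E e) ⟩
    sumFin n (λ v → if lookup (E e) v then sumWhere m (incident E v) x else 0ℚ)
                                     ≤⟨ sumFin-mono-≤ n on-e ⟩
    sumFin n (λ v → if lookup (E e) v then (if lookup (E e) v then 1ℚ else 0ℚ) else 0ℚ)
                                     ≡⟨ sumFin-∩ (E e) (E e) 1ℚ ⟩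
    1ℚ * ℕ→ℚ ∣ E e ∩ E e ∣          ≡⟨ *-identityˡ _ ⟩
    ℕ→ℚ ∣ E e ∩ E e ∣               ≡⟨ cong (λ s → ℕ→ℚ ∣ s ∣) (∩-idem (E e)) ⟩
    ℕ→ℚ ∣ E e ∣                     ∎
    where
    open ≤-Reasoning
    size·x : ℚ
    size·x = x e * ℕ→ℚ ∣ E e ∣
    self neighbour : Fin m → ℚ
    self f = if does (e F.≟ f) then size·x else 0ℚ
    neighbour f = if inN E e f then x f else 0ℚ
    on-e : ∀ v → (if lookup (E e) v then sumWhere m (incident E v) x else 0ℚ) ≤
                 (if lookup (E e) v then (if lookup (E e) v then 1ℚ else 0ℚ) else 0ℚ)
    on-e v with lookup (E e) v
    ... | true  = vertex-bound v
    ... | false = ≤-refl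

gFun-k : ∀ {n m} (E : Fin m → Subset n) {k} p q e → ∣ E e ∣ ≡ k → gFun E k p q e ≡ p
gFun-k E {k} p q e ∣e∣≡k = cong (λ b → if b then p else q) (dec-true (∣ E e ∣ ℕ.≟ k) ∣e∣≡k)

gFun-ℓ : ∀ {n m} (E : Fin m → Subset n) {k ℓ} → k ≢ ℓ → ∀ p q e → ∣ E e ∣ ≡ ℓ → gFun E k p q e ≡ q
gFun-ℓ E {k} k≢ℓ p q e ∣e∣≡ℓ = cong (λ b → if b then p else q)
  (dec-false (∣ E e ∣ ℕ.≟ k) (λ ∣e∣≡k → k≢ℓ (trans (sym ∣e∣≡k) ∣e∣≡ℓ)))

module TwoSizes {n m : ℕ} (E : Fin m → Subset n) {k ℓ : ℕ} (k≢ℓ : k ≢ ℓ)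
         (sizes : ∀ e → (∣ E e ∣ ≡ k) ⊎ (∣ E e ∣ ≡ ℓ)) where

  private
    size-k? size-ℓ? : Fin m → Bool
    size-k? f = ∣ E f ∣ ℕ.≡ᵇ k
    size-ℓ? f = ∣ E f ∣ ℕ.≡ᵇ ℓ

  ≡ᵇℓ≡not-≡ᵇk : ∀ f → (∣ E f ∣ ℕ.≡ᵇ ℓ) ≡ not (∣ E f ∣ ℕ.≡ᵇ k)
  ≡ᵇℓ≡not-≡ᵇk f with sizes f
  ... | inj₁ ∣f∣≡k = trans (dec-false (∣ E f ∣ ℕ.≟ ℓ) (λ ∣f∣≡ℓ → k≢ℓ (trans (sym ∣f∣≡k) ∣f∣≡ℓ)))
                           (cong not (sym (dec-true (∣ E f ∣ ℕ.≟ k) ∣f∣≡k)))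
  ... | inj₂ ∣f∣≡ℓ = trans (dec-true (∣ E f ∣ ℕ.≟ ℓ) ∣f∣≡ℓ)
                           (cong not (sym (dec-false (∣ E f ∣ ℕ.≟ k) (λ ∣f∣≡k → k≢ℓ (trans (sym ∣f∣≡k) ∣f∣≡ℓ)))))

  edge-bound : ∀ p q x → IsFracMatching E x → IsStuck E (gFun E k p q) x →
    ∀ e {K r} → ∣ E e ∣ ≡ K → gFun E k p q e ≡ r → 0ℚ ≤ r →
    x e * ((ℕ→ℚ K - 1ℚ) * r) <
      ℕ→ℚ K * r - 1ℚ + ((p * aSum E k x e + q * aSum E ℓ x e) - r * (aSum E k x e + aSum E ℓ x e))
  edge-bound p q x matching stuck e refl refl 0≤r = stuck-bound 0≤r
    (subst (λ s → x e * ℕ→ℚ ∣ E e ∣ + s ≤ ℕ→ℚ ∣ E e ∣)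
      (sumWhere-partition (inN E e) size-k? size-ℓ? ≡ᵇℓ≡not-≡ᵇk x)
      (neighbourhood-load E x matching e))
    (subst (1ℚ - gFun E k p q e * x e <_)
      (sumWhere-select (inN E e) size-k? size-ℓ? ≡ᵇℓ≡not-≡ᵇk p q x)
      (stuck e))

proposition15 : (k ℓ : ℕ) → 2 ℕ.≤ k → k ℕ.< ℓ →
    (n m : ℕ) (E : Fin m → Subset n) → Injective _≡_ _≡_ E →
    ((e : Fin m) → (∣ E e ∣ ≡ k) ⊎ (∣ E e ∣ ≡ ℓ)) →
    (p q : ℚ) → 0ℚ < p → p ≤ 1ℚ → 0ℚ < q → q ≤ 1ℚ → q ≤ p →
    (x : Fin m → ℚ) → IsReduced E x → IsBasic E x →
    IsStuck E (gFun E k p q) x →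
    ((e : Fin m) → ∣ E e ∣ ≡ k →
      x e * ((ℕ→ℚ k - 1ℚ) * p) < ℕ→ℚ k * p - 1ℚ - (p - q) * aSum E ℓ x e) ×
    ((f : Fin m) → ∣ E f ∣ ≡ ℓ →
      x f * ((ℕ→ℚ ℓ - 1ℚ) * q) < ℕ→ℚ ℓ * q - 1ℚ + (p - q) * aSum E k x f)
proposition15 k ℓ _ k<ℓ n m E _ sizes p q 0<p _ 0<q _ _ x _ (matching , _) stuck =
  (λ e ∣e∣≡k → subst (_ <_)
     (solve 5 (λ K p q a b → K :* p :- con 1ℚ :+ ((p :* a :+ q :* b) :- p :* (a :+ b))
                           := K :* p :- con 1ℚ :- (p :- q) :* b)
        refl (ℕ→ℚ k) p q (aSum E k x e) (aSum E ℓ x e))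
     (edge-bound p q x matching stuck e ∣e∣≡k (gFun-k E p q e ∣e∣≡k) (<⇒≤ 0<p))) ,
  (λ f ∣f∣≡ℓ → subst (_ <_)
     (solve 5 (λ L p q a b → L :* q :- con 1ℚ :+ ((p :* a :+ q :* b) :- q :* (a :+ b))
                           := L :* q :- con 1ℚ :+ (p :- q) :* a)
        refl (ℕ→ℚ ℓ) p q (aSum E k x f) (aSum E ℓ x f))
     (edge-bound p q x matching stuck f ∣f∣≡ℓ (gFun-ℓ E k≢ℓ p q f ∣f∣≡ℓ) (<⇒≤ 0<q)))
  where
  k≢ℓ : k ≢ ℓ
  k≢ℓ = ℕ.<⇒≢ k<ℓ
  open TwoSizes E k≢ℓ sizes using (edge-bound)
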